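{- With $H_n := 1+\frac12+\cdots+\frac1n$, the following hold: (a) $\sum_{k=1}^\infty \left(\frac{11 H_k}{4 k} -\frac{41 H_{k+1}}{3 (k+1)} + \frac{197 H_{k+2}}{12 (k+2)} - \frac{11 H_{k+3}}{2 (k+3)}\right) = -\frac{299}{144}$; (b) $\sum_{k=1}^\infty \left(\frac{73 H_k^2}{24 k} - \frac{11 H_{k+1}^2}{k+1} +\frac{97 H_{k+2}^2}{8 (k+2)} - \frac{25 H_{k+3}^2}{6 (k+3)}\right) = -\frac{6445}{5184}$; (c) $\sum_{k=1}^\infty \left(\frac{H_k^3}{3 k} - \frac{H_{k+1}^3}{k+1} + \frac{H_{k+2}^3}{k+2} -\frac{H_{k+3}^3}{3 (k+3)}\right) = -\frac{26}{243}$; (d) $\sum_{k=1}^\infty \left(\frac{H_k^4}{3 k} - \frac{H_{k+1}^4}{k+1} + \frac{H_{k+2}^4}{k+2} - \frac{H_{k+3}^4}{3 (k+3)}\right) = -\frac{577}{5832}$.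
   Context: $H_n := \sum_{j=1}^n \frac1j$ is the $n$th harmonic number. -}

module Defs where

open import Data.Nat using (ℕ; zero; suc; _≤_)
open import Data.Integer using (+_)
open import Data.Rational using (ℚ; 0ℚ; _+_; _-_; _*_; _/_; _<_; ∣_∣)
open import Data.Product using (∃)

-- inv k = 1/k for k ≥ 1 (inv 0 = 0 is a dummy value, never used below)
inv : ℕ → ℚ
inv zero = 0ℚ
inv (suc n) = + 1 / suc n

H : ℕ → ℚ
H zero = 0ℚ
H (suc n) = H n + inv (suc n)

_^_ : ℚ → ℕ → ℚ
x ^ zero = + 1 / 1
x ^ suc n = x * (x ^ n)

S : (ℕ → ℚ) → ℕ → ℚ
S a zero = 0ℚ
S a (suc n) = S a n + a (suc n)

SeriesSumsTo : (ℕ → ℚ) → ℚ → Set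
SeriesSumsTo a L = ∀ (ε : ℚ) → 0ℚ < ε → ∃ λ N → ∀ n → N ≤ n → ∣ S a n - L ∣ < ε

q : ℕ → ℕ → ℚ
q m n = + m / suc n

termA termB termC termD : ℕ → ℚ
termA k = (q 11 3 * H k * inv k - q 41 2 * H (suc k) * inv (suc k))
        + (q 197 11 * H (suc (suc k)) * inv (suc (suc k)) - q 11 1 * H (suc (suc (suc k))) * inv (suc (suc (suc k))))
termB k = (q 73 23 * (H k ^ 2) * inv k - q 11 0 * (H (suc k) ^ 2) * inv (suc k))
        + (q 97 7 * (H (suc (suc k)) ^ 2) * inv (suc (suc k)) - q 25 5 * (H (suc (suc (suc k))) ^ 2) * inv (suc (suc (suc k))))
termC k = (q 1 2 * (H k ^ 3) * inv k - (H (suc k) ^ 3) * inv (suc k))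
        + ((H (suc (suc k)) ^ 3) * inv (suc (suc k)) - q 1 2 * (H (suc (suc (suc k))) ^ 3) * inv (suc (suc (suc k))))
termD k = (q 1 2 * (H k ^ 4) * inv k - (H (suc k) ^ 4) * inv (suc k))
        + ((H (suc (suc k)) ^ 4) * inv (suc (suc k)) - q 1 2 * (H (suc (suc (suc k))) ^ 4) * inv (suc (suc (suc k))))

-- Each series has the form Σ_k (c₀ g(k) + c₁ g(k+1) + c₂ g(k+2) + c₃ g(k+3)) with g(k) = H_k^p / k
-- and c₀ + c₁ + c₂ + c₃ = 0, so its partial sums telescope: S_n = L + R_n, where
-- L = -(c₁ g(1) + c₂ (g(1) + g(2)) + c₃ (g(1) + g(2) + g(3))) and R_n is a fixed linear combination of
-- g(n+1), g(n+2), g(n+3).  It remains to see that H_k^p / k → 0 for p ≤ 4.  Splitting {1..m} into halves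
-- gives H_m ≤ j + 1 whenever m ≤ 2^j; taking 2^j between k and 2k, H_k^4 / k ≤ 2 (j+1)^4 / 2^j, and this
-- tends to 0 because (j+1)^6 ≤ 10^6 · 2^j.

module Submission where

open import Data.Empty using (⊥-elim)
open import Data.Integer as ℤ using (+_; -[1+_])
import Data.Integer.Properties as ℤP
import Data.Integer.Solver
open import Data.Nat as ℕ using (ℕ; zero; suc; z≤n; s≤s; ⌊_/2⌋; ⌈_/2⌉)
import Data.Nat.Properties as ℕP
import Data.Nat.Solver
open import Data.Product using (_×_; _,_; ∃; ∃₂)
open import Data.Rational as ℚ using (ℚ; mkℚ; 0ℚ; 1ℚ; _+_; _*_; _-_; -_; _/_; 1/_; _≤_; _<_; ∣_∣; toℚᵘ)
import Data.Rational.Properties as ℚP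
import Data.Rational.Solver
import Data.Rational.Unnormalised as ℚᵘ
import Data.Rational.Unnormalised.Properties as ℚᵘP
open import Relation.Binary.PropositionalEquality
open import Relation.Nullary using (yes; no)

open import Defs

ι : ℕ → ℚ
ι n = q n 0

toℚᵘ-q : ∀ m d → toℚᵘ (q m d) ℚᵘ.≃ ℚᵘ.mkℚᵘ (+ m) d
toℚᵘ-q m d = ℚP.toℚᵘ-fromℚᵘ (ℚᵘ.mkℚᵘ (+ m) d)

q≤q : ∀ {m d n e} → m ℕ.* suc e ℕ.≤ n ℕ.* suc d → q m d ≤ q n e
q≤q {m} {d} {n} {e} h = ℚP.toℚᵘ-cancel-≤
  (ℚᵘP.≤-respʳ-≃ (ℚᵘP.≃-sym (toℚᵘ-q n e)) (ℚᵘP.≤-respˡ-≃ (ℚᵘP.≃-sym (toℚᵘ-q m d))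
    (ℚᵘ.*≤* (subst₂ ℤ._≤_ (ℤP.pos-* m (suc e)) (ℤP.pos-* n (suc d)) (ℤ.+≤+ h)))))

q<q : ∀ {m d n e} → m ℕ.* suc e ℕ.< n ℕ.* suc d → q m d < q n e
q<q {m} {d} {n} {e} h = ℚP.toℚᵘ-cancel-<
  (ℚᵘP.<-respʳ-≃ (ℚᵘP.≃-sym (toℚᵘ-q n e)) (ℚᵘP.<-respˡ-≃ (ℚᵘP.≃-sym (toℚᵘ-q m d))
    (ℚᵘ.*<* (subst₂ ℤ._<_ (ℤP.pos-* m (suc e)) (ℤP.pos-* n (suc d)) (ℤ.+<+ h)))))

0≤q : ∀ m d → 0ℚ ≤ q m d
0≤q m d = q≤q {0} {0} {m} {d} z≤n

q≤1 : ∀ {n d} → n ℕ.≤ suc d → q n d ≤ 1ℚ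
q≤1 {n} {d} h = q≤q {n} {d} {1} {0} (subst₂ ℕ._≤_ (sym (ℕP.*-identityʳ n)) (sym (ℕP.*-identityˡ (suc d))) h)

q+q : ∀ m n d → q m d + q n d ≡ q (m ℕ.+ n) d
q+q m n d = ℚP.toℚᵘ-injective
  (ℚᵘP.≃-trans (ℚP.toℚᵘ-homo-+ (q m d) (q n d))
  (ℚᵘP.≃-trans (ℚᵘP.+-cong (toℚᵘ-q m d) (toℚᵘ-q n d))
  (ℚᵘP.≃-trans (ℚᵘ.*≡* (trans (common-denominator (+ m) (+ n) (+ suc d))
                                (cong (ℤ._* (+ suc d ℤ.* + suc d)) (sym (ℤP.pos-+ m n)))))
  (ℚᵘP.≃-sym (toℚᵘ-q (m ℕ.+ n) d)))))
  where
  open Data.Integer.Solver.+-*-Solver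
  common-denominator : ∀ a b c → (a ℤ.* c ℤ.+ b ℤ.* c) ℤ.* c ≡ (a ℤ.+ b) ℤ.* (c ℤ.* c)
  common-denominator = solve 3 (λ a b c → (a :* c :+ b :* c) :* c := (a :+ b) :* (c :* c)) refl

ι*q : ∀ m n d → ι m * q n d ≡ q (m ℕ.* n) d
ι*q m n d = ℚP.toℚᵘ-injective
  (ℚᵘP.≃-trans (ℚP.toℚᵘ-homo-* (ι m) (q n d))
  (ℚᵘP.≃-trans (ℚᵘP.*-cong (toℚᵘ-q m 0) (toℚᵘ-q n d))
  (ℚᵘP.≃-trans (ℚᵘ.*≡* (cong₂ ℤ._*_ (sym (ℤP.pos-* m n)) (cong +_ (sym (ℕP.*-identityˡ (suc d))))))
  (ℚᵘP.≃-sym (toℚᵘ-q (m ℕ.* n) d)))))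

positive⇒q : ∀ {ε} → 0ℚ < ε → ∃₂ λ m d → ε ≡ q (suc m) d
positive⇒q {ε@(mkℚ (+ suc m) d _)} _ = m , d , sym (ℚP.fromℚᵘ-toℚᵘ ε)
positive⇒q {mkℚ (+ zero) _ _} 0<ε with ℚ.positive 0<ε
... | ()
positive⇒q {mkℚ -[1+ _ ] _ _} 0<ε with ℚ.positive 0<ε
... | ()

p≤p+q : ∀ p {r} → 0ℚ ≤ r → p ≤ p + r
p≤p+q p 0≤r = subst (_≤ p + _) (ℚP.+-identityʳ p) (ℚP.+-monoʳ-≤ p 0≤r)

0≤* : ∀ {x y} → 0ℚ ≤ x → 0ℚ ≤ y → 0ℚ ≤ x * y
0≤* {x} {y} 0≤x 0≤y = ℚP.nonNegative⁻¹ (x * y)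
  {{ℚP.nonNeg*nonNeg⇒nonNeg x {{ℚ.nonNegative 0≤x}} y {{ℚ.nonNegative 0≤y}}}}

*-mono-≤-nonNeg : ∀ {w x y z} → 0ℚ ≤ x → 0ℚ ≤ y → w ≤ x → y ≤ z → w * y ≤ x * z
*-mono-≤-nonNeg {x = x} {y = y} 0≤x 0≤y w≤x y≤z = ℚP.≤-trans
  (ℚP.*-monoʳ-≤-nonNeg y {{ℚ.nonNegative 0≤y}} w≤x)
  (ℚP.*-monoˡ-≤-nonNeg x {{ℚ.nonNegative 0≤x}} y≤z)

^-nonNeg : ∀ {x} k → 0ℚ ≤ x → 0ℚ ≤ x ^ k
^-nonNeg zero    0≤x = 0≤q 1 0
^-nonNeg (suc k) 0≤x = 0≤* 0≤x (^-nonNeg k 0≤x)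

^-monoˡ-≤ : ∀ {x y} k → 0ℚ ≤ x → x ≤ y → x ^ k ≤ y ^ k
^-monoˡ-≤ zero    0≤x x≤y = ℚP.≤-refl
^-monoˡ-≤ (suc k) 0≤x x≤y =
  *-mono-≤-nonNeg (ℚP.≤-trans 0≤x x≤y) (^-nonNeg k 0≤x) x≤y (^-monoˡ-≤ k 0≤x x≤y)

^-monoʳ-≤ : ∀ {x j k} → 1ℚ ≤ x → j ℕ.≤ k → x ^ j ≤ x ^ k
^-monoʳ-≤ {x} {j} 1≤x j≤k = go (ℕP.≤⇒≤′ j≤k)
  where
  x^k≤x^[1+k] : ∀ k → x ^ k ≤ x ^ suc k
  x^k≤x^[1+k] k = subst (_≤ x ^ suc k) (ℚP.*-identityˡ (x ^ k))
    (ℚP.*-monoʳ-≤-nonNeg (x ^ k) {{ℚ.nonNegative (^-nonNeg k (ℚP.≤-trans (0≤q 1 0) 1≤x))}} 1≤x)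
  go : ∀ {k} → j ℕ.≤′ k → x ^ j ≤ x ^ k
  go ℕ.≤′-refl                 = ℚP.≤-refl
  go {suc k} (ℕ.≤′-step j≤′k) = ℚP.≤-trans (go j≤′k) (x^k≤x^[1+k] k)

ι-^ : ∀ m k → ι m ^ k ≡ ι (m ℕ.^ k)
ι-^ m zero    = refl
ι-^ m (suc k) = trans (cong (ι m *_) (ι-^ m k)) (ι*q m (m ℕ.^ k) 0)

-- SeriesSumsTo a L unfolds to Null (λ n → S a n - L).
Null : (ℕ → ℚ) → Set
Null f = ∀ ε → 0ℚ < ε → ∃ λ N → ∀ n → N ℕ.≤ n → ∣ f n ∣ < ε

null-≤ : ∀ {f g} → (∀ n → ∣ g n ∣ ≤ ∣ f n ∣) → Null f → Null g
null-≤ ∣g∣≤∣f∣ f-null ε 0<ε with f-null ε 0<ε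
... | N , small = N , λ n N≤n → ℚP.≤-<-trans (∣g∣≤∣f∣ n) (small n N≤n)

null-shift : ∀ {f} → Null f → Null (λ n → f (suc n))
null-shift f-null ε 0<ε with f-null ε 0<ε
... | N , small = N , λ n N≤n → small (suc n) (ℕP.m≤n⇒m≤1+n N≤n)

½ : ℚ
½ = + 1 / 2

0<ε⇒0<ε*½ : ∀ {ε} → 0ℚ < ε → 0ℚ < ε * ½
0<ε⇒0<ε*½ {ε} 0<ε = ℚP.positive⁻¹ (ε * ½) {{ℚP.pos*pos⇒pos ε {{ℚ.positive 0<ε}} ½}}

null-+ : ∀ {f g} → Null f → Null g → Null (λ n → f n + g n)
null-+ {f} {g} f-null g-null ε 0<ε with f-null (ε * ½) (0<ε⇒0<ε*½ 0<ε) | g-null (ε * ½) (0<ε⇒0<ε*½ 0<ε)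
... | M , f-small | N , g-small = M ℕ.⊔ N , λ n M⊔N≤n → begin-strict
  ∣ f n + g n ∣      ≤⟨ ℚP.∣p+q∣≤∣p∣+∣q∣ (f n) (g n) ⟩
  ∣ f n ∣ + ∣ g n ∣  <⟨ ℚP.+-mono-< (f-small n (ℕP.m⊔n≤o⇒m≤o M N M⊔N≤n)) (g-small n (ℕP.m⊔n≤o⇒n≤o M N M⊔N≤n)) ⟩
  ε * ½ + ε * ½      ≡⟨ halves ε ⟩
  ε                  ∎
  where
  open ℚP.≤-Reasoning
  open Data.Rational.Solver.+-*-Solver
  halves : ∀ x → x * ½ + x * ½ ≡ x
  halves = solve 1 (λ x → x :* con ½ :+ x :* con ½ := x) refl

null-scale : ∀ c {f} → Null f → Null (λ n → c * f n)
null-scale c {f} f-null ε 0<ε = scale (f-null (ε * 1/ r) 0<ε/r)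
  where
  r = ∣ c ∣ + 1ℚ
  instance
    r-pos : ℚ.Positive r
    r-pos = ℚP.nonNeg+pos⇒pos ∣ c ∣ {{ℚ.nonNegative (ℚP.0≤∣p∣ c)}} 1ℚ
    r≢0 : ℚ.NonZero r
    r≢0 = ℚP.pos⇒nonZero r
  0<ε/r : 0ℚ < ε * 1/ r
  0<ε/r = ℚP.positive⁻¹ (ε * 1/ r) {{ℚP.pos*pos⇒pos ε {{ℚ.positive 0<ε}} (1/ r) {{ℚP.1/pos⇒pos r}}}}
  r*[ε/r]≡ε : r * (ε * 1/ r) ≡ ε
  r*[ε/r]≡ε = begin
    r * (ε * 1/ r)  ≡⟨ ℚP.*-comm r (ε * 1/ r) ⟩
    ε * 1/ r * r    ≡⟨ ℚP.*-assoc ε (1/ r) r ⟩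
    ε * (1/ r * r)  ≡⟨ cong (ε *_) (ℚP.*-inverseˡ r) ⟩
    ε * 1ℚ          ≡⟨ ℚP.*-identityʳ ε ⟩
    ε               ∎
    where open ≡-Reasoning
  scale : (∃ λ N → ∀ n → N ℕ.≤ n → ∣ f n ∣ < ε * 1/ r) → ∃ λ N → ∀ n → N ℕ.≤ n → ∣ c * f n ∣ < ε
  scale (N , small) = N , λ n N≤n → begin-strict
    ∣ c * f n ∣      ≡⟨ ℚP.∣p*q∣≡∣p∣*∣q∣ c (f n) ⟩
    ∣ c ∣ * ∣ f n ∣  ≤⟨ ℚP.*-monoʳ-≤-nonNeg ∣ f n ∣ {{ℚ.nonNegative (ℚP.0≤∣p∣ (f n))}} (p≤p+q ∣ c ∣ (0≤q 1 0)) ⟩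
    r * ∣ f n ∣      <⟨ ℚP.*-monoʳ-<-pos r (small n N≤n) ⟩
    r * (ε * 1/ r)   ≡⟨ r*[ε/r]≡ε ⟩
    ε                ∎
    where open ℚP.≤-Reasoning

S-cong : ∀ {a b} → (∀ k → a k ≡ b k) → ∀ n → S a n ≡ S b n
S-cong a≡b zero    = refl
S-cong a≡b (suc n) = cong₂ _+_ (S-cong a≡b n) (a≡b (suc n))

sumsTo-cong : ∀ {a b L} → (∀ k → a k ≡ b k) → SeriesSumsTo a L → SeriesSumsTo b L
sumsTo-cong {L = L} a≡b = null-≤ λ n → ℚP.≤-reflexive (cong (λ s → ∣ s - L ∣) (sym (S-cong a≡b n)))

module Telescoping (g : ℕ → ℚ) (c₀ c₁ c₂ c₃ : ℚ) where

  combination : ℕ → ℚ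
  combination k = c₀ * g k + c₁ * g (suc k) + c₂ * g (suc (suc k)) + c₃ * g (suc (suc (suc k)))

  limit : ℚ
  limit = - (c₁ * g 1 + c₂ * (g 1 + g 2) + c₃ * (g 1 + g 2 + g 3))

  remainder : ℕ → ℚ
  remainder n = (c₁ + c₂ + c₃) * g (suc n) + (c₂ + c₃) * g (suc (suc n)) + c₃ * g (suc (suc (suc n)))

  module _ (c₀+c₁+c₂+c₃≡0 : c₀ + c₁ + c₂ + c₃ ≡ 0ℚ) where

    S-combination : ∀ n → S combination n - limit ≡ remainder n
    S-combination zero = initial c₁ c₂ c₃ (g 1) (g 2) (g 3)
      where
      open Data.Rational.Solver.+-*-Solver
      initial : ∀ c₁ c₂ c₃ x₁ x₂ x₃ → 0ℚ - - (c₁ * x₁ + c₂ * (x₁ + x₂) + c₃ * (x₁ + x₂ + x₃))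
                                      ≡ (c₁ + c₂ + c₃) * x₁ + (c₂ + c₃) * x₂ + c₃ * x₃
      initial = solve 6 (λ c₁ c₂ c₃ x₁ x₂ x₃ → con 0ℚ :- :- (c₁ :* x₁ :+ c₂ :* (x₁ :+ x₂) :+ c₃ :* (x₁ :+ x₂ :+ x₃))
                                      := (c₁ :+ c₂ :+ c₃) :* x₁ :+ (c₂ :+ c₃) :* x₂ :+ c₃ :* x₃) refl
    S-combination (suc n) = begin
      S combination n + combination (suc n) - limit        ≡⟨ swap (S combination n) (combination (suc n)) limit ⟩
      (S combination n - limit) + combination (suc n)      ≡⟨ cong (_+ combination (suc n)) (S-combination n) ⟩
      remainder n + combination (suc n)                    ≡⟨ shift c₀ c₁ c₂ c₃ (g (suc n)) (g (suc (suc n))) (g (suc (suc (suc n)))) (g (suc (suc (suc (suc n))))) ⟩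
      remainder (suc n) + (c₀ + c₁ + c₂ + c₃) * g (suc n)  ≡⟨ cong (λ c → remainder (suc n) + c * g (suc n)) c₀+c₁+c₂+c₃≡0 ⟩
      remainder (suc n) + 0ℚ * g (suc n)                   ≡⟨ drop (remainder (suc n)) (g (suc n)) ⟩
      remainder (suc n)                                    ∎
      where
      open ≡-Reasoning
      open Data.Rational.Solver.+-*-Solver
      swap : ∀ s x l → s + x - l ≡ (s - l) + x
      swap = solve 3 (λ s x l → s :+ x :- l := (s :- l) :+ x) refl
      shift : ∀ c₀ c₁ c₂ c₃ x₁ x₂ x₃ x₄ →
              ((c₁ + c₂ + c₃) * x₁ + (c₂ + c₃) * x₂ + c₃ * x₃) + (c₀ * x₁ + c₁ * x₂ + c₂ * x₃ + c₃ * x₄)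
              ≡ ((c₁ + c₂ + c₃) * x₂ + (c₂ + c₃) * x₃ + c₃ * x₄) + (c₀ + c₁ + c₂ + c₃) * x₁
      shift = solve 8 (λ c₀ c₁ c₂ c₃ x₁ x₂ x₃ x₄ →
              ((c₁ :+ c₂ :+ c₃) :* x₁ :+ (c₂ :+ c₃) :* x₂ :+ c₃ :* x₃) :+ (c₀ :* x₁ :+ c₁ :* x₂ :+ c₂ :* x₃ :+ c₃ :* x₄)
              := ((c₁ :+ c₂ :+ c₃) :* x₂ :+ (c₂ :+ c₃) :* x₃ :+ c₃ :* x₄) :+ (c₀ :+ c₁ :+ c₂ :+ c₃) :* x₁) refl
      drop : ∀ r x → r + 0ℚ * x ≡ r
      drop = solve 2 (λ r x → r :+ con 0ℚ :* x := r) refl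

    combination-sumsTo : Null g → SeriesSumsTo combination limit
    combination-sumsTo g-null = null-≤ (λ n → ℚP.≤-reflexive (cong ∣_∣ (S-combination n)))
      (null-+ (null-+ (null-scale (c₁ + c₂ + c₃) (null-shift g-null))
                      (null-scale (c₂ + c₃) (null-shift (null-shift g-null))))
              (null-scale c₃ (null-shift (null-shift (null-shift g-null)))))

0≤inv : ∀ n → 0ℚ ≤ inv n
0≤inv zero    = ℚP.≤-refl
0≤inv (suc n) = 0≤q 1 n

inv-antimono : ∀ {m n} → m ℕ.≤ n → inv (suc n) ≤ inv (suc m)
inv-antimono {m} {n} m≤n = q≤q {1} {n} {1} {m} (ℕP.*-monoʳ-≤ 1 (s≤s m≤n))

H-mono : ∀ {m n} → m ℕ.≤ n → H m ≤ H n
H-mono {m} {n} m≤n = go (ℕP.≤⇒≤′ m≤n)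
  where
  go : ∀ {m n} → m ℕ.≤′ n → H m ≤ H n
  go ℕ.≤′-refl                   = ℚP.≤-refl
  go {n = suc n} (ℕ.≤′-step m≤′n) = ℚP.≤-trans (go m≤′n) (p≤p+q (H n) (0≤inv (suc n)))

0≤H : ∀ n → 0ℚ ≤ H n
0≤H n = H-mono {0} {n} z≤n

1≤H : ∀ n → 1ℚ ≤ H (suc n)
1≤H n = H-mono {1} {suc n} (s≤s z≤n)

H-+-≤ : ∀ a b → H (a ℕ.+ b) ≤ H a + q b a
H-+-≤ a zero = subst (_≤ H a + q 0 a) (cong H (sym (ℕP.+-identityʳ a))) (p≤p+q (H a) (0≤q 0 a))
H-+-≤ a (suc b) = begin
  H (a ℕ.+ suc b)                    ≡⟨ cong H (ℕP.+-suc a b) ⟩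
  H (a ℕ.+ b) + inv (suc (a ℕ.+ b))  ≤⟨ ℚP.+-mono-≤ (H-+-≤ a b) (inv-antimono (ℕP.m≤m+n a b)) ⟩
  H a + q b a + q 1 a                ≡⟨ ℚP.+-assoc (H a) (q b a) (q 1 a) ⟩
  H a + (q b a + q 1 a)              ≡⟨ cong (λ x → H a + x) (q+q b 1 a) ⟩
  H a + q (b ℕ.+ 1) a                ≡⟨ cong (λ n → H a + q n a) (ℕP.+-comm b 1) ⟩
  H a + q (suc b) a                  ∎
  where open ℚP.≤-Reasoning

⌈[n+n]/2⌉≡n : ∀ n → ⌈ n ℕ.+ n /2⌉ ≡ n
⌈[n+n]/2⌉≡n zero    = refl
⌈[n+n]/2⌉≡n (suc n) = cong suc (trans (cong ⌊_/2⌋ (ℕP.+-suc n n)) (⌈[n+n]/2⌉≡n n))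

H-≤-pow2 : ∀ j {m} → m ℕ.≤ 2 ℕ.^ j → H m ≤ ι (suc j)
H-≤-pow2 zero {zero}          _ = 0≤q 1 0
H-≤-pow2 zero {suc zero}      _ = ℚP.≤-refl
H-≤-pow2 zero {suc (suc _)}   (s≤s ())
H-≤-pow2 (suc j) {m} m≤2^[1+j] = begin
  H m                            ≡⟨ cong H (sym halves) ⟩
  H (⌈ m /2⌉ ℕ.+ ⌊ m /2⌋)        ≤⟨ H-+-≤ ⌈ m /2⌉ ⌊ m /2⌋ ⟩
  H ⌈ m /2⌉ + q ⌊ m /2⌋ ⌈ m /2⌉  ≤⟨ ℚP.+-mono-≤ (H-≤-pow2 j ⌈m/2⌉≤2^j) (q≤1 (ℕP.m≤n⇒m≤1+n (ℕP.⌊n/2⌋≤⌈n/2⌉ m))) ⟩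
  ι (suc j) + 1ℚ                 ≡⟨ q+q (suc j) 1 0 ⟩
  ι (suc j ℕ.+ 1)                ≡⟨ cong ι (ℕP.+-comm (suc j) 1) ⟩
  ι (suc (suc j))                ∎
  where
  open ℚP.≤-Reasoning
  halves : ⌈ m /2⌉ ℕ.+ ⌊ m /2⌋ ≡ m
  halves = trans (ℕP.+-comm ⌈ m /2⌉ ⌊ m /2⌋) (ℕP.⌊n/2⌋+⌈n/2⌉≡n m)
  ⌈m/2⌉≤2^j : ⌈ m /2⌉ ℕ.≤ 2 ℕ.^ j
  ⌈m/2⌉≤2^j = ℕP.≤-trans (ℕP.⌈n/2⌉-mono m≤2^[1+j])
    (ℕP.≤-reflexive (trans (cong (λ x → ⌈ 2 ℕ.^ j ℕ.+ x /2⌉) (ℕP.+-identityʳ (2 ℕ.^ j))) (⌈[n+n]/2⌉≡n (2 ℕ.^ j))))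

pow2-bracket : ∀ n → ∃ λ j → suc n ℕ.≤ 2 ℕ.^ j × 2 ℕ.^ j ℕ.≤ suc n ℕ.+ suc n
pow2-bracket zero = 0 , ℕP.≤-refl , s≤s z≤n
pow2-bracket (suc n) with pow2-bracket n
... | j , n<2^j , 2^j≤2[1+n] with suc (suc n) ℕ.≤? 2 ℕ.^ j
...   | yes 2+n≤2^j = j , 2+n≤2^j , ℕP.≤-trans 2^j≤2[1+n] (ℕP.+-mono-≤ (ℕP.n≤1+n (suc n)) (ℕP.n≤1+n (suc n)))
...   | no  2^j≤1+n = suc j , ℕP.≤-trans (s≤s (ℕP.m≤n+m (suc n) n)) (ℕP.≤-reflexive (sym 2^[1+j]≡2[1+n]))
                            , ℕP.≤-trans (ℕP.≤-reflexive 2^[1+j]≡2[1+n]) (ℕP.+-mono-≤ (ℕP.n≤1+n (suc n)) (ℕP.n≤1+n (suc n)))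
  where
  2^j≡1+n : 2 ℕ.^ j ≡ suc n
  2^j≡1+n = ℕP.≤-antisym (ℕP.≤-pred (ℕP.≰⇒> 2^j≤1+n)) n<2^j
  2^[1+j]≡2[1+n] : 2 ℕ.^ suc j ≡ suc n ℕ.+ suc n
  2^[1+j]≡2[1+n] = trans (cong (2 ℕ.*_) 2^j≡1+n) (cong (suc n ℕ.+_) (ℕP.+-identityʳ (suc n)))

2^m≤2^n⇒m≤n : ∀ {m n} → 2 ℕ.^ m ℕ.≤ 2 ℕ.^ n → m ℕ.≤ n
2^m≤2^n⇒m≤n 2^m≤2^n = ℕP.≮⇒≥ (λ n<m → ℕP.<⇒≱ (ℕP.^-monoʳ-< 2 (s≤s (s≤s z≤n)) n<m) 2^m≤2^n)

[n+11]^6≤2[n+10]^6 : ∀ n → (n ℕ.+ 11) ℕ.^ 6 ℕ.≤ 2 ℕ.* (n ℕ.+ 10) ℕ.^ 6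
[n+11]^6≤2[n+10]^6 n = subst ((n ℕ.+ 11) ℕ.^ 6 ℕ.≤_) (expansion n) (ℕP.m≤m+n _ _)
  where
  open Data.Nat.Solver.+-*-Solver
  -- the coefficients of 2 (n + 10)^6 - (n + 11)^6, all nonnegative
  expansion : ∀ n → (n ℕ.+ 11) ℕ.^ 6 ℕ.+ (n ℕ.^ 6 ℕ.+ 54 ℕ.* n ℕ.^ 5 ℕ.+ 1185 ℕ.* n ℕ.^ 4 ℕ.+ 13380 ℕ.* n ℕ.^ 3
                  ℕ.+ 80385 ℕ.* n ℕ.^ 2 ℕ.+ 233694 ℕ.* n ℕ.+ 228439) ≡ 2 ℕ.* (n ℕ.+ 10) ℕ.^ 6
  expansion = solve 1 (λ n → (n :+ con 11) :^ 6 :+ (n :^ 6 :+ con 54 :* n :^ 5 :+ con 1185 :* n :^ 4 :+ con 13380 :* n :^ 3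
                  :+ con 80385 :* n :^ 2 :+ con 233694 :* n :+ con 228439) := con 2 :* (n :+ con 10) :^ 6) refl

[n+10]^6≤10⁶*2^n : ∀ n → (n ℕ.+ 10) ℕ.^ 6 ℕ.≤ 1000000 ℕ.* 2 ℕ.^ n
[n+10]^6≤10⁶*2^n zero    = ℕP.≤-refl
[n+10]^6≤10⁶*2^n (suc n) = begin
  (suc n ℕ.+ 10) ℕ.^ 6           ≡⟨ cong (ℕ._^ 6) (ℕP.+-suc n 10) ⟨
  (n ℕ.+ 11) ℕ.^ 6               ≤⟨ [n+11]^6≤2[n+10]^6 n ⟩
  2 ℕ.* (n ℕ.+ 10) ℕ.^ 6          ≤⟨ ℕP.*-monoʳ-≤ 2 ([n+10]^6≤10⁶*2^n n) ⟩
  2 ℕ.* (1000000 ℕ.* 2 ℕ.^ n)     ≡⟨ ℕP.*-comm 2 (1000000 ℕ.* 2 ℕ.^ n) ⟩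
  1000000 ℕ.* 2 ℕ.^ n ℕ.* 2       ≡⟨ ℕP.*-assoc 1000000 (2 ℕ.^ n) 2 ⟩
  1000000 ℕ.* (2 ℕ.^ n ℕ.* 2)     ≡⟨ cong (1000000 ℕ.*_) (ℕP.*-comm (2 ℕ.^ n) 2) ⟩
  1000000 ℕ.* 2 ℕ.^ suc n        ∎
  where open ℕP.≤-Reasoning

[1+n]^6≤10⁶*2^n : ∀ n → suc n ℕ.^ 6 ℕ.≤ 1000000 ℕ.* 2 ℕ.^ n
[1+n]^6≤10⁶*2^n n = ℕP.≤-trans (ℕP.^-monoˡ-≤ 6 (ℕP.≤-trans (ℕP.≤-reflexive (ℕP.+-comm 1 n)) (ℕP.+-monoʳ-≤ n (s≤s z≤n)))) ([n+10]^6≤10⁶*2^n n)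

[1+j]^4*[1+d]<[1+m]*k : ∀ c m d j k → suc j ℕ.^ 6 ℕ.≤ c ℕ.* 2 ℕ.^ j → 2 ℕ.* c ℕ.* suc d ℕ.≤ j →
                        2 ℕ.^ j ℕ.≤ k ℕ.+ k → suc j ℕ.^ 4 ℕ.* suc d ℕ.< suc m ℕ.* k
[1+j]^4*[1+d]<[1+m]*k c m d j k poly≤exp 2c[1+d]≤j 2^j≤2k = ℕP.*-cancelˡ-< (2 ℕ.* c) _ _ (begin-strict
  2 ℕ.* c ℕ.* (A ℕ.* suc d)    ≡⟨ reassoc (2 ℕ.* c) A (suc d) ⟩
  A ℕ.* (2 ℕ.* c ℕ.* suc d)    ≤⟨ ℕP.*-monoʳ-≤ A 2c[1+d]≤j ⟩
  A ℕ.* j                      <⟨ ℕP.*-monoʳ-< A (ℕP.n<1+n j) ⟩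
  A ℕ.* suc j                  ≤⟨ ℕP.m≤m*n (A ℕ.* suc j) (suc j) ⟩
  A ℕ.* suc j ℕ.* suc j        ≡⟨ sixth-power (suc j) ⟩
  suc j ℕ.^ 6                  ≤⟨ poly≤exp ⟩
  c ℕ.* 2 ℕ.^ j                ≤⟨ ℕP.*-monoʳ-≤ c 2^j≤2k ⟩
  c ℕ.* (k ℕ.+ k)              ≡⟨ doubling c k ⟩
  2 ℕ.* c ℕ.* k                ≤⟨ ℕP.*-monoʳ-≤ (2 ℕ.* c) (ℕP.m≤n*m k (suc m)) ⟩
  2 ℕ.* c ℕ.* (suc m ℕ.* k)    ∎)
  where
  open ℕP.≤-Reasoning
  open Data.Nat.Solver.+-*-Solver
  A = suc j ℕ.^ 4
  instance
    A≢0 : ℕ.NonZero A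
    A≢0 = ℕP.m^n≢0 (suc j) 4
  reassoc : ∀ x y z → x ℕ.* (y ℕ.* z) ≡ y ℕ.* (x ℕ.* z)
  reassoc = solve 3 (λ x y z → x :* (y :* z) := y :* (x :* z)) refl
  sixth-power : ∀ x → x ℕ.^ 4 ℕ.* x ℕ.* x ≡ x ℕ.^ 6
  sixth-power = solve 1 (λ x → x :^ 4 :* x :* x := x :^ 6) refl
  doubling : ∀ x y → x ℕ.* (y ℕ.+ y) ≡ 2 ℕ.* x ℕ.* y
  doubling = solve 2 (λ x y → x :* (y :+ y) := con 2 :* x :* y) refl

harmonicPowerRatio : ℕ → ℕ → ℚ
harmonicPowerRatio p k = H k ^ p * inv k

0≤harmonicPowerRatio : ∀ p k → 0ℚ ≤ harmonicPowerRatio p k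
0≤harmonicPowerRatio p k = 0≤* (^-nonNeg p (0≤H k)) (0≤inv k)

harmonicPowerRatio-4-null : ∀ c → (∀ n → suc n ℕ.^ 6 ℕ.≤ c ℕ.* 2 ℕ.^ n) → Null (harmonicPowerRatio 4)
harmonicPowerRatio-4-null c poly≤exp ε 0<ε with positive⇒q 0<ε
... | m , d , refl = 2 ℕ.^ j₀ , bound
  where
  j₀ = 2 ℕ.* c ℕ.* suc d
  bound : ∀ n → 2 ℕ.^ j₀ ℕ.≤ n → ∣ harmonicPowerRatio 4 n ∣ < q (suc m) d
  bound zero 2^j₀≤0 = ⊥-elim (ℕP.<⇒≱ (ℕP.m^n>0 2 j₀) 2^j₀≤0)
  bound (suc k) 2^j₀≤1+k with pow2-bracket k
  ... | j , 1+k≤2^j , 2^j≤2[1+k] = begin-strict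
    ∣ harmonicPowerRatio 4 (suc k) ∣  ≡⟨ ℚP.0≤p⇒∣p∣≡p (0≤harmonicPowerRatio 4 (suc k)) ⟩
    H (suc k) ^ 4 * q 1 k             ≤⟨ ℚP.*-monoʳ-≤-nonNeg (q 1 k) {{ℚ.nonNegative (0≤q 1 k)}}
                                           (^-monoˡ-≤ 4 (0≤H (suc k)) (H-≤-pow2 j 1+k≤2^j)) ⟩
    ι (suc j) ^ 4 * q 1 k             ≡⟨ cong (_* q 1 k) (ι-^ (suc j) 4) ⟩
    ι (suc j ℕ.^ 4) * q 1 k           ≡⟨ ι*q (suc j ℕ.^ 4) 1 k ⟩
    q (suc j ℕ.^ 4 ℕ.* 1) k           <⟨ q<q {suc j ℕ.^ 4 ℕ.* 1} {k} {suc m} {d} numerators ⟩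
    q (suc m) d                       ∎
    where
    open ℚP.≤-Reasoning
    j₀≤j : j₀ ℕ.≤ j
    j₀≤j = 2^m≤2^n⇒m≤n (ℕP.≤-trans 2^j₀≤1+k 1+k≤2^j)
    numerators : suc j ℕ.^ 4 ℕ.* 1 ℕ.* suc d ℕ.< suc m ℕ.* suc k
    numerators = subst (λ x → x ℕ.* suc d ℕ.< suc m ℕ.* suc k) (sym (ℕP.*-identityʳ (suc j ℕ.^ 4)))
      ([1+j]^4*[1+d]<[1+m]*k c m d j (suc k) (poly≤exp j) j₀≤j 2^j≤2[1+k])

harmonicPowerRatio-mono : ∀ {p p′} → p ℕ.≤ p′ → ∀ k → harmonicPowerRatio p k ≤ harmonicPowerRatio p′ k
harmonicPowerRatio-mono {p} {p′} p≤p′ zero =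
  ℚP.≤-reflexive (trans (ℚP.*-zeroʳ (H 0 ^ p)) (sym (ℚP.*-zeroʳ (H 0 ^ p′))))
harmonicPowerRatio-mono p≤p′ (suc k) =
  ℚP.*-monoʳ-≤-nonNeg (inv (suc k)) {{ℚ.nonNegative (0≤inv (suc k))}} (^-monoʳ-≤ (1≤H k) p≤p′)

harmonicPowerRatio-null : ∀ {p} → p ℕ.≤ 4 → Null (harmonicPowerRatio p)
harmonicPowerRatio-null {p} p≤4 = null-≤ ∣ratio∣≤∣ratio₄∣ (harmonicPowerRatio-4-null 1000000 [1+n]^6≤10⁶*2^n)
  where
  ∣ratio∣≤∣ratio₄∣ : ∀ k → ∣ harmonicPowerRatio p k ∣ ≤ ∣ harmonicPowerRatio 4 k ∣
  ∣ratio∣≤∣ratio₄∣ k = subst₂ _≤_ (sym (ℚP.0≤p⇒∣p∣≡p (0≤harmonicPowerRatio p k))) (sym (ℚP.0≤p⇒∣p∣≡p (0≤harmonicPowerRatio 4 k)))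
    (harmonicPowerRatio-mono p≤4 k)

weighted-sum-shape : ∀ a b c e x₀ y₀ x₁ y₁ x₂ y₂ x₃ y₃ →
  a * (x₀ * y₀) + - b * (x₁ * y₁) + c * (x₂ * y₂) + - e * (x₃ * y₃)
  ≡ (a * x₀ * y₀ - b * x₁ * y₁) + (c * x₂ * y₂ - e * x₃ * y₃)
weighted-sum-shape = solve 12 (λ a b c e x₀ y₀ x₁ y₁ x₂ y₂ x₃ y₃ →
  a :* (x₀ :* y₀) :+ :- b :* (x₁ :* y₁) :+ c :* (x₂ :* y₂) :+ :- e :* (x₃ :* y₃)
  := (a :* x₀ :* y₀ :- b :* x₁ :* y₁) :+ (c :* x₂ :* y₂ :- e :* x₃ :* y₃)) refl
  where open Data.Rational.Solver.+-*-Solver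

symmetric-sum-shape : ∀ a x₀ y₀ x₁ y₁ x₂ y₂ x₃ y₃ →
  a * (x₀ * y₀) + - 1ℚ * (x₁ * y₁) + 1ℚ * (x₂ * y₂) + - a * (x₃ * y₃)
  ≡ (a * x₀ * y₀ - x₁ * y₁) + (x₂ * y₂ - a * x₃ * y₃)
symmetric-sum-shape = solve 9 (λ a x₀ y₀ x₁ y₁ x₂ y₂ x₃ y₃ →
  a :* (x₀ :* y₀) :+ :- con 1ℚ :* (x₁ :* y₁) :+ con 1ℚ :* (x₂ :* y₂) :+ :- a :* (x₃ :* y₃)
  := (a :* x₀ :* y₀ :- x₁ :* y₁) :+ (x₂ :* y₂ :- a :* x₃ :* y₃)) refl
  where open Data.Rational.Solver.+-*-Solver

module A = Telescoping (λ k → H k * inv k) (q 11 3) (- q 41 2) (q 197 11) (- q 11 1)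
module B = Telescoping (harmonicPowerRatio 2) (q 73 23) (- q 11 0) (q 97 7) (- q 25 5)
module C = Telescoping (harmonicPowerRatio 3) (q 1 2) (- 1ℚ) 1ℚ (- q 1 2)
module D = Telescoping (harmonicPowerRatio 4) (q 1 2) (- 1ℚ) 1ℚ (- q 1 2)

-- The vanishing of the coefficient sums (refl) and the values of A.limit, …, D.limit are closed
-- rational computations, checked by evaluation.
lemma2p3 : SeriesSumsTo termA (-[1+ 298 ] / 144)
         × SeriesSumsTo termB (-[1+ 6444 ] / 5184)
         × SeriesSumsTo termC (-[1+ 25 ] / 243)
         × SeriesSumsTo termD (-[1+ 576 ] / 5832)
lemma2p3 = sumsTo-cong {L = A.limit} shapeA (A.combination-sumsTo refl H/k-null)
         , sumsTo-cong {L = B.limit} shapeB (B.combination-sumsTo refl (harmonicPowerRatio-null (s≤s (s≤s z≤n))))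
         , sumsTo-cong {L = C.limit} shapeC (C.combination-sumsTo refl (harmonicPowerRatio-null (s≤s (s≤s (s≤s z≤n)))))
         , sumsTo-cong {L = D.limit} shapeD (D.combination-sumsTo refl (harmonicPowerRatio-null ℕP.≤-refl))
  where
  H/k-null : Null (λ k → H k * inv k)
  H/k-null = null-≤ (λ k → ℚP.≤-reflexive (cong (λ h → ∣ h * inv k ∣) (sym (ℚP.*-identityʳ (H k)))))
                    (harmonicPowerRatio-null (s≤s z≤n))
  shapeA : ∀ k → A.combination k ≡ termA k
  shapeA k = weighted-sum-shape (q 11 3) (q 41 2) (q 197 11) (q 11 1)
    (H k) (inv k) (H (suc k)) (inv (suc k)) (H (suc (suc k))) (inv (suc (suc k))) (H (suc (suc (suc k)))) (inv (suc (suc (suc k))))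
  shapeB : ∀ k → B.combination k ≡ termB k
  shapeB k = weighted-sum-shape (q 73 23) (q 11 0) (q 97 7) (q 25 5)
    (H k ^ 2) (inv k) (H (suc k) ^ 2) (inv (suc k)) (H (suc (suc k)) ^ 2) (inv (suc (suc k))) (H (suc (suc (suc k))) ^ 2) (inv (suc (suc (suc k))))
  shapeC : ∀ k → C.combination k ≡ termC k
  shapeC k = symmetric-sum-shape (q 1 2)
    (H k ^ 3) (inv k) (H (suc k) ^ 3) (inv (suc k)) (H (suc (suc k)) ^ 3) (inv (suc (suc k))) (H (suc (suc (suc k))) ^ 3) (inv (suc (suc (suc k))))
  shapeD : ∀ k → D.combination k ≡ termD k
  shapeD k = symmetric-sum-shape (q 1 2)
    (H k ^ 4) (inv k) (H (suc k) ^ 4) (inv (suc k)) (H (suc (suc k)) ^ 4) (inv (suc (suc k))) (H (suc (suc (suc k))) ^ 4) (inv (suc (suc (suc k))))
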